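{- Let $k\ge 1$. Let $\mathcal{H}$ be the bi-hypergraph obtained from $\mathcal{H}_{2k+1}$ by adding two new vertices $u$ and $v$, removing the edge $\{v_{1,1},v_{1,2},v_{1,3}\}$, and adding the edges $\{u,v_{1,1},v_{1,2}\}$, $\{v,v_{1,2},v_{1,3}\}$, and, for all $j\in\{1,2\}$, the edges $\{u,v_{1,j},v_{2k+1,j}\}$ and $\{v,v_{1,j+1},v_{2k+1,j+1}\}$. Then $\mathcal{H}$ is minimal uncolorable.
   Context: A bi-hypergraph is a pair $(\mathcal{V},\mathcal{E})$ with $\mathcal{V}$ a finite set and $\mathcal{E}$ a family of subsets of $\mathcal{V}$ (edges). A proper coloring is a map $f:\mathcal{V}\to\mathbb{N}$ with $1<|\{f(x):x\in e\}|<|e|$ for every edge $e$; a bi-hypergraph is colorable if such $f$ exists. A subhypergraph is $(\mathcal{V}',\mathcal{E}')$ with $\mathcal{V}'\subseteq\mathcal{V}$, $\mathcal{E}'\subseteq\mathcal{E}$; a bi-hypergraph is minimal uncolorable if it is uncolorable but each of its proper subhypergraphs is colorable. For $k\ge 2$, let $V_i=\{v_{i,1},v_{i,2},v_{i,3}\}$ ($i\in[k]$) be pairwise disjoint sets, and write $v_{i,4}=v_{i,1}$, $v_{i,5}=v_{i,2}$. The bi-hypergraph $\mathcal{H}_k$ has vertex set $V_1\cup\cdots\cup V_k$ and edge set consisting of the edges $V_i$ for all $i\in[k]$, together with the edges $\{v_{q+1,j},v_{q,j},v_{q,j+t}\}$ for all $q\in[k-1]$, $j\in\{1,2,3\}$,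 $t\in\{1,2\}$. -}

module Defs where

open import Data.Nat using (ℕ; zero; suc; _+_; _*_; _<_)
open import Data.Nat.Properties using () renaming (_≟_ to _≟ℕ_)
open import Data.Fin using (Fin; zero; suc; combine; _↑ˡ_; _↑ʳ_; inject₁; fromℕ)
open import Data.Fin.Subset using (Subset; ⁅_⁆; _∪_; _∈_; _⊆_; ∣_∣; ⊤)
open import Data.Fin.Subset.Properties using (_∈?_)
open import Data.List using (List; []; _∷_; _++_; map; filter; length; concatMap; allFin; lookup)
open import Data.List.Base using (deduplicate)
open import Data.Product using (_×_; ∃; Σ)
open import Data.Sum using (_⊎_)
open import Relation.Nullary using (¬_)
open import Relation.Binary.PropositionalEquality using (_≡_; _≢_)

record BiHypergraph : Set where
  field
    n    : ℕ
    m    : ℕ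
    edge : Fin m → Subset n
open BiHypergraph public

elems : ∀ {n} → Subset n → List (Fin n)
elems {n} e = filter (_∈? e) (allFin n)

numColors : ∀ {n} → (Fin n → ℕ) → Subset n → ℕ
numColors f e = length (deduplicate _≟ℕ_ (map f (elems e)))

GoodOn : ∀ {n} → (Fin n → ℕ) → Subset n → Set
GoodOn f e = (1 < numColors f e) × (numColors f e < ∣ e ∣)

ProperColoring : (H : BiHypergraph) → (Fin (n H) → ℕ) → Set
ProperColoring H f = ∀ (e : Fin (m H)) → GoodOn f (edge H e)

Colorable : BiHypergraph → Set
Colorable H = ∃ λ (f : Fin (n H) → ℕ) → ProperColoring H f

record Subhypergraph (H : BiHypergraph) : Set where
  field
    V'    : Subset (n H)
    E'    : Subset (m H)
    edges⊆V' : ∀ (e : Fin (m H)) → e ∈ E' → edge H e ⊆ V'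
open Subhypergraph public

IsProper : ∀ {H} → Subhypergraph H → Set
IsProper S = ¬ ((V' S ≡ ⊤) × (E' S ≡ ⊤))

-- A coloring of V' (given as a map on all vertices; only values on V' matter,
-- since all edges of E' lie inside V').
SubColorable : ∀ {H} → Subhypergraph H → Set
SubColorable {H} S =
  ∃ λ (f : Fin (n H) → ℕ) → ∀ (e : Fin (m H)) → e ∈ E' S → GoodOn f (edge H e)

MinimalUncolorable : BiHypergraph → Set
MinimalUncolorable H =
  (¬ Colorable H) × (∀ (S : Subhypergraph H) → IsProper S → SubColorable S)

-- Layers i ∈ Fin (2k+1) (0-indexed: layer i is V_{i+1} of the paper),
-- positions j ∈ Fin 3 (0-indexed: j is index j+1 of the paper).
-- Vertices: Fin ((2k+1)*3 + 2); the last two are u and v.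

K : ℕ → ℕ
K k = suc (2 * k)

N : ℕ → ℕ
N k = K k * 3 + 2

vtx : ∀ k → Fin (K k) → Fin 3 → Fin (N k)
vtx k i j = combine i j ↑ˡ 2

uV : ∀ k → Fin (N k)
uV k = K k * 3 ↑ʳ zero

vV : ∀ k → Fin (N k)
vV k = K k * 3 ↑ʳ (suc zero)

-- j ↦ j+1 modulo 3 (matches the convention v_{i,4}=v_{i,1}, v_{i,5}=v_{i,2})
next : Fin 3 → Fin 3
next zero = suc zero
next (suc zero) = suc (suc zero)
next (suc (suc zero)) = zero

triple : ∀ {n} → Fin n → Fin n → Fin n → Subset n
triple a b c = ⁅ a ⁆ ∪ ⁅ b ⁆ ∪ ⁅ c ⁆

-- Edges V_i for the paper's i = 2, …, 2k+1
layerEdges : ∀ k → List (Subset (N k))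
layerEdges k = map (λ (i : Fin (2 * k)) →
  triple (vtx k (suc i) zero) (vtx k (suc i) (suc zero)) (vtx k (suc i) (suc (suc zero))))
  (allFin (2 * k))

-- Edges {v_{q+1,j}, v_{q,j}, v_{q,j+t}}, q ∈ [2k], j ∈ {1,2,3}, t ∈ {1,2}
crossEdges : ∀ k → List (Subset (N k))
crossEdges k = concatMap (λ (q : Fin (2 * k)) → concatMap (λ (j : Fin 3) →
     triple (vtx k (suc q) j) (vtx k (inject₁ q) j) (vtx k (inject₁ q) (next j))
   ∷ triple (vtx k (suc q) j) (vtx k (inject₁ q) j) (vtx k (inject₁ q) (next (next j)))
   ∷ []) (allFin 3)) (allFin (2 * k))

newEdges : ∀ k → List (Subset (N k))
newEdges k =
    triple (uV k) (v1 zero) (v1 (suc zero))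
  ∷ triple (vV k) (v1 (suc zero)) (v1 (suc (suc zero)))
  ∷ concatMap (λ (j : Fin 3) →
        triple (uV k) (v1 j) (vl j)
      ∷ triple (vV k) (v1 (next j)) (vl (next j))
      ∷ []) (zero ∷ suc zero ∷ [])
  where
    v1 : Fin 3 → Fin (N k)
    v1 = vtx k zero
    vl : Fin 3 → Fin (N k)
    vl = vtx k (fromℕ (2 * k))

edgeList : ∀ k → List (Subset (N k))
edgeList k = layerEdges k ++ crossEdges k ++ newEdges k

Hlemma : ℕ → BiHypergraph
Hlemma k = record
  { n    = N k
  ; m    = length (edgeList k)
  ; edge = lookup (edgeList k)
  }

-- Number the layers of H_{2k+1} from 0 (the layer V₁, no longer an edge) to 2k and read a colouring
-- as its sequence of layer colourings together with the colours of u and v.  A crossing out of a monochromatic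
-- layer makes the next layer avoid that colour, a crossing out of a rainbow layer copies it, and a crossing between
-- two-coloured layers changes the colour at every position.  So if layer 0 is monochromatic, every later layer
-- avoids its colour and the edges through u and v force layer 2k to be monochromatic; if it is rainbow, so is
-- layer 1; and if it is two-coloured, after the even number 2k of crossings layer 2k equals layer 0, and the edges
-- through u and v force it to be monochromatic.  Conversely, once any one edge is deleted the rest is coloured by a
-- monochromatic layer 0 followed by alternating two-coloured layers, changing the palette (or inserting a
-- monochromatic layer) exactly at the deleted edge; next to layer 0 and at u and v a finite table is used instead.

module Submission where

open import Data.Bool using (Bool; true; false; not; if_then_else_; _xor_)
open import Data.Bool.Properties using (not-injective; not-involutive)
open import Data.Empty using (⊥-elim)
open import Data.Fin as Fin
  using (Fin; zero; suc; toℕ; fromℕ; fromℕ<; inject₁; combine; remQuot; splitAt; join; _↑ˡ_; _↑ʳ_)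
  renaming (_≟_ to _≟ᶠ_)
open import Data.Fin.Properties
  using (all?; ¬∀⟶∃¬; toℕ-injective; toℕ≤pred[n]; toℕ-fromℕ<; fromℕ<-toℕ; toℕ-fromℕ; toℕ-inject₁; toℕ<n;
         combine-injective; ↑ˡ-injective; splitAt-↑ˡ; splitAt-↑ʳ; join-splitAt; combine-remQuot; remQuot-combine)
open import Data.Fin.Subset using (Subset; ⁅_⁆; _∪_; ∣_∣; ⊤; inside; outside) renaming (_∈_ to _∈ₛ_)
open import Data.Fin.Subset.Properties
  using (_∈?_; x∈p∪q⁻; x∈p∪q⁺; x∈⁅x⁆; x∈⁅y⁆⇒x≡y; ⊆-antisym; ⊆⊤)
open import Data.List
  using (List; []; _∷_; _++_; length; map; filter; tabulate; allFin; removeAt; deduplicate; concatMap;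
         cartesianProduct; lookup)
open import Data.List.Properties using (length-removeAt′; map-++; map-∘)
open import Data.List.Membership.Propositional using () renaming (_∈_ to _∈ˡ_)
open import Data.List.Membership.Propositional.Properties
  using (∈-filter⁺; ∈-filter⁻; ∈-allFin; ∈-map⁺; ∈-map⁻; ∈-deduplicate⁺; ∈-deduplicate⁻; ∈-++⁺ˡ; ∈-++⁺ʳ;
         ∈-cartesianProduct⁺; ∈-lookup)
open import Data.List.Relation.Binary.Subset.Propositional using (_⊆_)
open import Data.List.Relation.Unary.Any as Any using (here; there)
open import Data.List.Relation.Unary.Any.Properties using (lookup-index)
open import Data.List.Relation.Unary.All as All using ([]; _∷_)
open import Data.List.Relation.Unary.AllPairs using ([]; _∷_)
open import Data.List.Relation.Unary.Unique.Propositional using (Unique)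
import Data.List.Relation.Unary.Unique.Propositional.Properties as Unique
import Data.List.Relation.Unary.Unique.DecPropositional.Properties as DecUnique
open import Data.Nat using (ℕ; zero; suc; _+_; _*_; _∸_; _≤_; _<_; z≤n; s≤s; _≟_; _<?_)
open import Data.Nat.Properties
  using (≤-antisym; ≤-trans; ≤-refl; <-irrefl; <⇒≤; n≤1+n; 1+n≢n; +-suc; +-identityʳ; <⇒≱; ≮⇒≥; <-cmp;
         <-trans; n<1+n; n∸n≡0; m≤n⇒m≤1+n; +-∸-assoc; ≤-pred; suc-injective; m∸n≡0⇒m≤n; 0∸n≡0)
open import Data.Product using (_×_; _,_; proj₁; proj₂; ∃; uncurry)
open import Data.Product.Properties using () renaming (≡-dec to ×-≡-dec)
open import Data.Sum as Sum using (_⊎_; inj₁; inj₂; [_,_]′)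
open import Data.Sum.Properties using (≡-dec; inj₁-injective; inj₂-injective)
open import Data.Vec using (_∷_)
open import Function using (_∘_; id; _⇔_; mk⇔; case_of_; Equivalence)
open import Relation.Nullary using (¬_; Dec; yes; no; does)
open import Relation.Nullary.Decidable using (¬?; _×-dec_; _→-dec_; toWitness)
open import Relation.Binary.Definitions using (DecidableEquality; tri<; tri≈; tri>)
open import Relation.Binary.PropositionalEquality

open import Defs

∈-removeAt : ∀ {A : Set} {x y : A} {xs} (y∈xs : y ∈ˡ xs) → x ∈ˡ xs → x ≢ y →
             x ∈ˡ removeAt xs (Any.index y∈xs)
∈-removeAt (here refl) (here refl) x≢y = ⊥-elim (x≢y refl)
∈-removeAt (here _)    (there x∈) _    = x∈
∈-removeAt (there _)   (here eq)  _    = here eq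
∈-removeAt (there y∈)  (there x∈) x≢y  = there (∈-removeAt y∈ x∈ x≢y)

unique-⊆⇒length≤ : ∀ {A : Set} {xs ys : List A} → Unique xs → xs ⊆ ys → length xs ≤ length ys
unique-⊆⇒length≤ {xs = []}     _            _    = z≤n
unique-⊆⇒length≤ {xs = x ∷ xs} {ys} (x∉ ∷ !xs) x∷xs⊆ys =
  subst (suc (length xs) ≤_) (sym (length-removeAt′ ys (Any.index x∈ys)))
    (s≤s (unique-⊆⇒length≤ !xs λ w∈xs →
      ∈-removeAt x∈ys (x∷xs⊆ys (there w∈xs)) λ w≡x → All.lookup x∉ w∈xs (sym w≡x)))
  where x∈ys = x∷xs⊆ys (here refl)

∈-elems⁺ : ∀ {d} {e : Subset d} {x} → x ∈ₛ e → x ∈ˡ elems e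
∈-elems⁺ {e = e} {x} = ∈-filter⁺ (_∈? e) (∈-allFin x)

∈-elems⁻ : ∀ {d} {e : Subset d} {x} → x ∈ˡ elems e → x ∈ₛ e
∈-elems⁻ {d} {e} = proj₂ ∘ ∈-filter⁻ (_∈? e) {xs = allFin d}

elems-unique : ∀ {d} (e : Subset d) → Unique (elems e)
elems-unique {d} e = Unique.filter⁺ (_∈? e) (Unique.allFin⁺ d)

private
  length-filter-∷ : ∀ {d c} x (p : Subset d) (g : Fin c → Fin d) →
    length (filter (_∈? (x ∷ p)) (tabulate (suc ∘ g))) ≡ length (filter (_∈? p) (tabulate g))
  length-filter-∷ {c = zero}  x p g = refl
  length-filter-∷ {c = suc c} x p g with g zero ∈? p
  ... | yes _ = cong suc (length-filter-∷ x p (g ∘ suc))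
  ... | no  _ = length-filter-∷ x p (g ∘ suc)

∣p∣≡length-elems : ∀ {d} (p : Subset d) → ∣ p ∣ ≡ length (elems p)
∣p∣≡length-elems {zero}  Data.Vec.[]  = refl
∣p∣≡length-elems {suc d} (inside ∷ p)  =
  cong suc (trans (∣p∣≡length-elems p) (sym (length-filter-∷ inside p id)))
∣p∣≡length-elems {suc d} (outside ∷ p) =
  trans (∣p∣≡length-elems p) (sym (length-filter-∷ outside p id))

module _ {d : ℕ} (a b c : Fin d) where

  ∈-triple⁻ : ∀ {x} → x ∈ₛ triple a b c → x ≡ a ⊎ x ≡ b ⊎ x ≡ c
  ∈-triple⁻ x∈ with x∈p∪q⁻ ⁅ a ⁆ (⁅ b ⁆ ∪ ⁅ c ⁆) x∈
  ... | inj₁ x∈a = inj₁ (x∈⁅y⁆⇒x≡y a x∈a)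
  ... | inj₂ x∈bc with x∈p∪q⁻ ⁅ b ⁆ ⁅ c ⁆ x∈bc
  ...   | inj₁ x∈b = inj₂ (inj₁ (x∈⁅y⁆⇒x≡y b x∈b))
  ...   | inj₂ x∈c = inj₂ (inj₂ (x∈⁅y⁆⇒x≡y c x∈c))

  ∈-triple₁ : a ∈ₛ triple a b c
  ∈-triple₁ = x∈p∪q⁺ (inj₁ (x∈⁅x⁆ a))

  ∈-triple₂ : b ∈ₛ triple a b c
  ∈-triple₂ = x∈p∪q⁺ {p = ⁅ a ⁆} (inj₂ (x∈p∪q⁺ (inj₁ (x∈⁅x⁆ b))))

  ∈-triple₃ : c ∈ₛ triple a b c
  ∈-triple₃ = x∈p∪q⁺ {p = ⁅ a ⁆} (inj₂ (x∈p∪q⁺ {p = ⁅ b ⁆} (inj₂ (x∈⁅x⁆ c))))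

  ∣triple∣≡3 : a ≢ b → b ≢ c → a ≢ c → ∣ triple a b c ∣ ≡ 3
  ∣triple∣≡3 a≢b b≢c a≢c = trans (∣p∣≡length-elems (triple a b c)) (≤-antisym
    (unique-⊆⇒length≤ (elems-unique (triple a b c)) elems⊆abc)
    (unique-⊆⇒length≤ ((a≢b ∷ a≢c ∷ []) ∷ (b≢c ∷ []) ∷ [] ∷ []) abc⊆elems))
    where
    elems⊆abc : elems (triple a b c) ⊆ a ∷ b ∷ c ∷ []
    elems⊆abc x∈ with ∈-triple⁻ (∈-elems⁻ x∈)
    ... | inj₁ x≡a        = here x≡a
    ... | inj₂ (inj₁ x≡b) = there (here x≡b)
    ... | inj₂ (inj₂ x≡c) = there (there (here x≡c))
    abc⊆elems : a ∷ b ∷ c ∷ [] ⊆ elems (triple a b c)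
    abc⊆elems (here refl)                 = ∈-elems⁺ ∈-triple₁
    abc⊆elems (there (here refl))         = ∈-elems⁺ ∈-triple₂
    abc⊆elems (there (there (here refl))) = ∈-elems⁺ ∈-triple₃

TwoColours : ℕ → ℕ → ℕ → Set
TwoColours x y z = ¬ (x ≡ y × y ≡ z) × ¬ (x ≢ y × y ≢ z × x ≢ z)

twoColours? : ∀ x y z → Dec (TwoColours x y z)
twoColours? x y z = ¬? (x ≟ y ×-dec y ≟ z) ×-dec ¬? (¬? (x ≟ y) ×-dec ¬? (y ≟ z) ×-dec ¬? (x ≟ z))

module _ {d : ℕ} (f : Fin d → ℕ) (a b c : Fin d) where

  private
    Colour : ℕ → Set
    Colour w = w ≡ f a ⊎ w ≡ f b ⊎ w ≡ f c

    colours : List ℕ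
    colours = deduplicate _≟_ (map f (elems (triple a b c)))

    colours⊆ : ∀ ws → (∀ {w} → Colour w → w ∈ˡ ws) → numColors f (triple a b c) ≤ length ws
    colours⊆ ws colour⇒∈ = unique-⊆⇒length≤ (DecUnique.deduplicate-! _≟_ _) λ w∈ →
      let x , x∈ , w≡fx = ∈-map⁻ f (∈-deduplicate⁻ _≟_ _ w∈) in
      colour⇒∈ (subst Colour (sym w≡fx) (colour-of (∈-triple⁻ a b c (∈-elems⁻ x∈))))
      where
      colour-of : ∀ {x} → x ≡ a ⊎ x ≡ b ⊎ x ≡ c → Colour (f x)
      colour-of (inj₁ refl)        = inj₁ refl
      colour-of (inj₂ (inj₁ refl)) = inj₂ (inj₁ refl)
      colour-of (inj₂ (inj₂ refl)) = inj₂ (inj₂ refl)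

    ⊆colours : ∀ ws → Unique ws → (∀ {w} → w ∈ˡ ws → Colour w) → length ws ≤ numColors f (triple a b c)
    ⊆colours ws !ws ∈⇒colour = unique-⊆⇒length≤ !ws λ w∈ws → case (∈⇒colour w∈ws)
      where
      colour-∈ : ∀ {x} → x ∈ₛ triple a b c → f x ∈ˡ colours
      colour-∈ x∈ = ∈-deduplicate⁺ _≟_ (∈-map⁺ f (∈-elems⁺ x∈))
      case : ∀ {w} → Colour w → w ∈ˡ colours
      case (inj₁ refl)        = colour-∈ (∈-triple₁ a b c)
      case (inj₂ (inj₁ refl)) = colour-∈ (∈-triple₂ a b c)
      case (inj₂ (inj₂ refl)) = colour-∈ (∈-triple₃ a b c)

    atMostTwo : ∀ x y → (∀ {w} → Colour w → w ≡ x ⊎ w ≡ y) → numColors f (triple a b c) ≤ 2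
    atMostTwo x y covers = colours⊆ (x ∷ y ∷ []) (pair ∘ covers)
      where
      pair : ∀ {w} → w ≡ x ⊎ w ≡ y → w ∈ˡ x ∷ y ∷ []
      pair (inj₁ w≡x) = here w≡x
      pair (inj₂ w≡y) = there (here w≡y)

    atLeastTwo : ∀ x y → x ≢ y → Colour x → Colour y → 2 ≤ numColors f (triple a b c)
    atLeastTwo x y x≢y x-col y-col = ⊆colours (x ∷ y ∷ []) ((x≢y ∷ []) ∷ [] ∷ [])
      λ { (here refl) → x-col ; (there (here refl)) → y-col }

  goodOn-triple⇔ : a ≢ b → b ≢ c → a ≢ c → GoodOn f (triple a b c) ⇔ TwoColours (f a) (f b) (f c)
  goodOn-triple⇔ a≢b b≢c a≢c = mk⇔ to from
    where
    size = ∣triple∣≡3 a b c a≢b b≢c a≢c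

    to : GoodOn f (triple a b c) → TwoColours (f a) (f b) (f c)
    to (1<k , k<3) = one-colour , three-colours
      where
      one-colour : ¬ (f a ≡ f b × f b ≡ f c)
      one-colour (ab , bc) = <-irrefl refl (≤-trans 1<k (colours⊆ (f a ∷ []) λ
        { (inj₁ refl) → here refl
        ; (inj₂ (inj₁ refl)) → here (sym ab)
        ; (inj₂ (inj₂ refl)) → here (sym (trans ab bc)) }))
      three-colours : ¬ (f a ≢ f b × f b ≢ f c × f a ≢ f c)
      three-colours (ab , bc , ac) = <-irrefl refl (≤-trans (subst (numColors f (triple a b c) <_) size k<3)
        (⊆colours (f a ∷ f b ∷ f c ∷ []) ((ab ∷ ac ∷ []) ∷ (bc ∷ []) ∷ [] ∷ [])
          λ { (here refl)                 → inj₁ refl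
            ; (there (here refl))         → inj₂ (inj₁ refl)
            ; (there (there (here refl))) → inj₂ (inj₂ refl) }))

    from : TwoColours (f a) (f b) (f c) → GoodOn f (triple a b c)
    from (one , three) = lower , subst (numColors f (triple a b c) <_) (sym size) (s≤s upper)
      where
      lower : 1 < numColors f (triple a b c)
      lower with f a ≟ f b | f b ≟ f c
      ... | no ab  | _      = atLeastTwo (f a) (f b) ab (inj₁ refl) (inj₂ (inj₁ refl))
      ... | yes _  | no bc  = atLeastTwo (f b) (f c) bc (inj₂ (inj₁ refl)) (inj₂ (inj₂ refl))
      ... | yes ab | yes bc = ⊥-elim (one (ab , bc))
      upper : numColors f (triple a b c) ≤ 2
      upper with f a ≟ f b | f b ≟ f c | f a ≟ f c
      ... | yes ab | _      | _      = atMostTwo (f a) (f c) λ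
        { (inj₁ refl) → inj₁ refl ; (inj₂ (inj₁ refl)) → inj₁ (sym ab) ; (inj₂ (inj₂ refl)) → inj₂ refl }
      ... | no _   | yes bc | _      = atMostTwo (f a) (f b) λ
        { (inj₁ refl) → inj₁ refl ; (inj₂ (inj₁ refl)) → inj₂ refl ; (inj₂ (inj₂ refl)) → inj₂ (sym bc) }
      ... | no _   | no _   | yes ac = atMostTwo (f a) (f b) λ
        { (inj₁ refl) → inj₁ refl ; (inj₂ (inj₁ refl)) → inj₂ refl ; (inj₂ (inj₂ refl)) → inj₁ (sym ac) }
      ... | no ab  | no bc  | no ac  = ⊥-elim (three (ab , bc , ac))

twoColours-≢ : ∀ {x y z} → y ≡ z → TwoColours x y z → x ≢ y
twoColours-≢ y≡z (one , _) x≡y = one (x≡y , y≡z)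

module _ {x y z : ℕ} where

  twoColours-∈ : TwoColours x y z → y ≢ z → x ≡ y ⊎ x ≡ z
  twoColours-∈ (_ , three) y≢z with x ≟ y | x ≟ z
  ... | yes x≡y | _       = inj₁ x≡y
  ... | no  _   | yes x≡z = inj₂ x≡z
  ... | no  x≢y | no  x≢z = ⊥-elim (three (x≢y , y≢z , x≢z))

  twoColours-outer : TwoColours x y z → x ≢ y → z ≢ y → x ≡ z
  twoColours-outer ok x≢y z≢y with twoColours-∈ ok (z≢y ∘ sym)
  ... | inj₁ x≡y = ⊥-elim (x≢y x≡y)
  ... | inj₂ x≡z = x≡z

  twoColours-≡ : TwoColours x y z → x ≢ y → x ≢ z → y ≡ z
  twoColours-≡ (_ , three) x≢y x≢z with y ≟ z
  ... | yes y≡z = y≡z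
  ... | no  y≢z = ⊥-elim (three (x≢y , y≢z , x≢z))

  colour-trichotomy : (x ≡ y × y ≡ z) ⊎ (x ≢ y × y ≢ z × x ≢ z) ⊎ TwoColours x y z
  colour-trichotomy with x ≟ y | y ≟ z | x ≟ z
  ... | yes x≡y | yes y≡z | _       = inj₁ (x≡y , y≡z)
  ... | no  x≢y | no  y≢z | no  x≢z = inj₂ (inj₁ (x≢y , y≢z , x≢z))
  ... | yes x≡y | no  y≢z | _       = inj₂ (inj₂ ((λ (_ , y≡z) → y≢z y≡z) , λ (x≢y , _) → x≢y x≡y))
  ... | no  x≢y | yes y≡z | _       = inj₂ (inj₂ ((λ (x≡y , _) → x≢y x≡y) , λ (_ , y≢z , _) → y≢z y≡z))
  ... | no  x≢y | no  y≢z | yes x≡z = inj₂ (inj₂ ((λ (x≡y , _) → x≢y x≡y) , λ (_ , _ , x≢z) → x≢z x≡z))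

OneOf : ℕ → ℕ → ℕ → Set
OneOf a b x = x ≡ a ⊎ x ≡ b

module _ {a b : ℕ} where

  oneOf-≡ : ∀ {p q r} → OneOf a b p → OneOf a b q → OneOf a b r → p ≢ q → q ≢ r → p ≡ r
  oneOf-≡ (inj₁ refl) (inj₁ refl) _           p≢q _   = ⊥-elim (p≢q refl)
  oneOf-≡ (inj₂ refl) (inj₂ refl) _           p≢q _   = ⊥-elim (p≢q refl)
  oneOf-≡ _           (inj₁ refl) (inj₁ refl) _   q≢r = ⊥-elim (q≢r refl)
  oneOf-≡ _           (inj₂ refl) (inj₂ refl) _   q≢r = ⊥-elim (q≢r refl)
  oneOf-≡ (inj₁ refl) (inj₂ refl) (inj₁ refl) _   _   = refl
  oneOf-≡ (inj₂ refl) (inj₁ refl) (inj₂ refl) _   _   = refl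

  oneOf⇒twoColours : ∀ {x y z} → OneOf a b x → OneOf a b y → OneOf a b z →
                     ¬ (x ≡ y × y ≡ z) → TwoColours x y z
  oneOf⇒twoColours x∈ y∈ z∈ one = one , λ (x≢y , y≢z , x≢z) → x≢z (oneOf-≡ x∈ y∈ z∈ x≢y y≢z)

Layer : Set
Layer = Fin 3 → ℕ

LayerOK : Layer → Set
LayerOK X = TwoColours (X zero) (X (suc zero)) (X (suc (suc zero)))

Monochrome : ℕ → Layer → Set
Monochrome c X = ∀ j → X j ≡ c

Avoids : ℕ → Layer → Set
Avoids c X = ∀ j → X j ≢ c

Rainbow : Layer → Set
Rainbow X = ∀ {j j′} → j ≢ j′ → X j ≢ X j′

Palette : ℕ → ℕ → Layer → Set
Palette a b X = ∀ j → OneOf a b (X j)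

Crossing : Layer → Layer → Set
Crossing X Y = ∀ {j j′} → j ≢ j′ → TwoColours (Y j) (X j) (X j′)

third : ∀ {j j′ : Fin 3} → j ≢ j′ → ∃ λ j″ → j ≢ j″ × j′ ≢ j″
third {zero}             {zero}             j≢j′ = ⊥-elim (j≢j′ refl)
third {zero}             {suc zero}         _    = suc (suc zero) , (λ ()) , (λ ())
third {zero}             {suc (suc zero)}   _    = suc zero , (λ ()) , (λ ())
third {suc zero}         {zero}             _    = suc (suc zero) , (λ ()) , (λ ())
third {suc zero}         {suc zero}         j≢j′ = ⊥-elim (j≢j′ refl)
third {suc zero}         {suc (suc zero)}   _    = zero , (λ ()) , (λ ())
third {suc (suc zero)}   {zero}             _    = suc zero , (λ ()) , (λ ())
third {suc (suc zero)}   {suc zero}         _    = zero , (λ ()) , (λ ())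
third {suc (suc zero)}   {suc (suc zero)}   j≢j′ = ⊥-elim (j≢j′ refl)

module _ {X : Layer} where

  layerOK⇒¬monochrome : ∀ {c} → LayerOK X → ¬ Monochrome c X
  layerOK⇒¬monochrome (one , _) mono = one (trans (mono _) (sym (mono _)) , trans (mono _) (sym (mono _)))

  layerOK⇒¬rainbow : LayerOK X → ¬ Rainbow X
  layerOK⇒¬rainbow (_ , three) rainbow = three (rainbow (λ ()) , rainbow (λ ()) , rainbow (λ ()))

  layerOK⇒other : LayerOK X → ∀ j → ∃ λ j′ → X j ≢ X j′
  layerOK⇒other ok j =
    let j′ , X[j′]≢ = ¬∀⟶∃¬ 3 (λ j′ → X j′ ≡ X j) (λ j′ → X j′ ≟ X j) (layerOK⇒¬monochrome ok)
    in j′ , X[j′]≢ ∘ sym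

  layerOK⇒palette : LayerOK X → ∃ λ a → ∃ λ b → Palette a b X
  layerOK⇒palette ok with X (suc zero) ≟ X (suc (suc zero))
  ... | yes x₁≡x₂ = X zero , X (suc zero) ,
    λ { zero → inj₁ refl ; (suc zero) → inj₂ refl ; (suc (suc zero)) → inj₂ (sym x₁≡x₂) }
  ... | no x₁≢x₂ = X (suc zero) , X (suc (suc zero)) ,
    λ { zero → twoColours-∈ ok x₁≢x₂ ; (suc zero) → inj₁ refl ; (suc (suc zero)) → inj₂ refl }

j≢next : ∀ (j : Fin 3) → j ≢ next j
j≢next zero             ()
j≢next (suc zero)       ()
j≢next (suc (suc zero)) ()

module _ {X Y : Layer} (cross : Crossing X Y) where

  crossing-from-monochrome : ∀ {c} → Monochrome c X → Avoids c Y
  crossing-from-monochrome mono j Yj≡c =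
    twoColours-≢ (trans (mono j) (sym (mono (next j)))) (cross (j≢next j)) (trans Yj≡c (sym (mono j)))

  crossing-reuses : LayerOK X → ∀ j → ∃ λ j′ → Y j ≡ X j′
  crossing-reuses ok j with layerOK⇒other ok j
  ... | j′ , Xj≢Xj′ with twoColours-∈ (cross (Xj≢Xj′ ∘ cong X)) Xj≢Xj′
  ...   | inj₁ Yj≡Xj  = j , Yj≡Xj
  ...   | inj₂ Yj≡Xj′ = j′ , Yj≡Xj′

  crossing-avoids : ∀ {c} → LayerOK X → Avoids c X → Avoids c Y
  crossing-avoids ok avoids j Yj≡c =
    let j′ , Yj≡Xj′ = crossing-reuses ok j in avoids j′ (trans (sym Yj≡Xj′) Yj≡c)

  crossing-palette : ∀ {a b} → LayerOK X → Palette a b X → Palette a b Y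
  crossing-palette ok pal j = let j′ , Yj≡Xj′ = crossing-reuses ok j in subst (OneOf _ _) (sym Yj≡Xj′) (pal j′)

  crossing-from-rainbow : Rainbow X → ∀ j → Y j ≡ X j
  crossing-from-rainbow rainbow j with third (j≢next j)
  ... | j″ , j≢j″ , next≢j″ with twoColours-∈ (cross (j≢next j)) (rainbow (j≢next j))
                               | twoColours-∈ (cross j≢j″) (rainbow j≢j″)
  ...   | inj₁ Yj≡Xj | _          = Yj≡Xj
  ...   | inj₂ _     | inj₁ Yj≡Xj = Yj≡Xj
  ...   | inj₂ Yj≡X′ | inj₂ Yj≡X″ = ⊥-elim (rainbow next≢j″ (trans (sym Yj≡X′) Yj≡X″))

  -- If Y j = X j, the other two positions of X carry the other colour of the palette, and then every position
  -- of Y is forced to the colour X j.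
  crossing-flips : ∀ {a b} → Palette a b X → LayerOK Y → ∀ j → Y j ≢ X j
  crossing-flips pal okY j Yj≡Xj = layerOK⇒¬monochrome okY all-Xj
    where
    Xj≢ : ∀ {j′} → j ≢ j′ → X j ≢ X j′
    Xj≢ j≢j′ Xj≡Xj′ = proj₁ (cross j≢j′) (Yj≡Xj , Xj≡Xj′)

    all-Xj : Monochrome (X j) Y
    all-Xj j′ with j ≟ᶠ j′
    ... | yes refl = Yj≡Xj
    ... | no j≢j′ with third j≢j′
    ...   | j″ , j≢j″ , j′≢j″ =
      let Xj′≡Xj″ = oneOf-≡ (pal j′) (pal j) (pal j″) (Xj≢ j≢j′ ∘ sym) (Xj≢ j≢j″)
          Yj′≢Xj′ = twoColours-≢ Xj′≡Xj″ (cross j′≢j″)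
      in case twoColours-∈ (cross (j≢j′ ∘ sym)) (Xj≢ j≢j′ ∘ sym) of λ
        { (inj₁ Yj′≡Xj′) → ⊥-elim (Yj′≢Xj′ Yj′≡Xj′) ; (inj₂ Yj′≡Xj) → Yj′≡Xj }

crossing-twice : ∀ {a b X Y W} → Palette a b X → LayerOK X →
                 Crossing X Y → LayerOK Y → Crossing Y W → LayerOK W → ∀ j → W j ≡ X j
crossing-twice palX okX XY okY YW okW j =
  let palY = crossing-palette XY okX palX
  in oneOf-≡ (crossing-palette YW okY palY j) (palY j) (palX j)
       (crossing-flips YW palY okW j) (crossing-flips XY palX okY j)

monochrome-crossing : ∀ {c Y} → Avoids c Y → Crossing (λ _ → c) Y
monochrome-crossing avoids {j} _ = (λ (Yj≡c , _) → avoids j Yj≡c) , λ (_ , c≢c , _) → c≢c refl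

distinct⇒rainbow : ∀ {X : Layer} → X zero ≢ X (suc zero) → X (suc zero) ≢ X (suc (suc zero)) →
                   X zero ≢ X (suc (suc zero)) → Rainbow X
distinct⇒rainbow x₀≢x₁ x₁≢x₂ x₀≢x₂ {zero}           {zero}           j≢j′ = ⊥-elim (j≢j′ refl)
distinct⇒rainbow x₀≢x₁ x₁≢x₂ x₀≢x₂ {zero}           {suc zero}       _    = x₀≢x₁
distinct⇒rainbow x₀≢x₁ x₁≢x₂ x₀≢x₂ {zero}           {suc (suc zero)} _    = x₀≢x₂
distinct⇒rainbow x₀≢x₁ x₁≢x₂ x₀≢x₂ {suc zero}       {zero}           _    = x₀≢x₁ ∘ sym
distinct⇒rainbow x₀≢x₁ x₁≢x₂ x₀≢x₂ {suc zero}       {suc zero}       j≢j′ = ⊥-elim (j≢j′ refl)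
distinct⇒rainbow x₀≢x₁ x₁≢x₂ x₀≢x₂ {suc zero}       {suc (suc zero)} _    = x₁≢x₂
distinct⇒rainbow x₀≢x₁ x₁≢x₂ x₀≢x₂ {suc (suc zero)} {zero}           _    = x₀≢x₂ ∘ sym
distinct⇒rainbow x₀≢x₁ x₁≢x₂ x₀≢x₂ {suc (suc zero)} {suc zero}       _    = x₁≢x₂ ∘ sym
distinct⇒rainbow x₀≢x₁ x₁≢x₂ x₀≢x₂ {suc (suc zero)} {suc (suc zero)} j≢j′ = ⊥-elim (j≢j′ refl)

-- The edges through u and v, numbered as in newEdges; Z is the first layer and W the last.
AttachOK : Fin 6 → Layer → Layer → ℕ → ℕ → Set
AttachOK zero                                Z W u v = TwoColours u (Z zero) (Z (suc zero))
AttachOK (suc zero)                          Z W u v = TwoColours v (Z (suc zero)) (Z (suc (suc zero)))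
AttachOK (suc (suc zero))                    Z W u v = TwoColours u (Z zero) (W zero)
AttachOK (suc (suc (suc zero)))              Z W u v = TwoColours v (Z (suc zero)) (W (suc zero))
AttachOK (suc (suc (suc (suc zero))))        Z W u v = TwoColours u (Z (suc zero)) (W (suc zero))
AttachOK (suc (suc (suc (suc (suc zero))))) Z W u v = TwoColours v (Z (suc (suc zero))) (W (suc (suc zero)))

Attached : Layer → Layer → ℕ → ℕ → Set
Attached Z W u v = ∀ i → AttachOK i Z W u v

module _ {Z W : Layer} {u v : ℕ} (attached : Attached Z W u v) where

  attached-monochrome : ∀ {c} → Monochrome c Z → Avoids c W → ¬ LayerOK W
  attached-monochrome {c} mono avoids (one , _) = one (trans W₀≡u (sym W₁≡u) , trans W₁≡v (sym W₂≡v))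
    where
    first-avoids : ∀ {x} → TwoColours x (Z zero) (Z (suc zero)) → x ≢ c
    first-avoids ok x≡c = twoColours-≢ (trans (mono zero) (sym (mono (suc zero)))) ok (trans x≡c (sym (mono zero)))
    meet : ∀ {x j j′} → x ≢ c → TwoColours x (Z j) (W j′) → W j′ ≡ x
    meet {j = j} {j′} x≢c ok = sym (twoColours-outer ok (λ x≡Zj → x≢c (trans x≡Zj (mono j)))
                                                       (λ Wj′≡Zj → avoids j′ (trans Wj′≡Zj (mono j))))
    u≢c = first-avoids (attached zero)
    v≢c : v ≢ c
    v≢c v≡c = twoColours-≢ (trans (mono (suc zero)) (sym (mono (suc (suc zero))))) (attached (suc zero))
                           (trans v≡c (sym (mono (suc zero))))
    W₀≡u = meet u≢c (attached (suc (suc zero)))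
    W₁≡v = meet v≢c (attached (suc (suc (suc zero))))
    W₁≡u = meet u≢c (attached (suc (suc (suc (suc zero)))))
    W₂≡v = meet v≢c (attached (suc (suc (suc (suc (suc zero))))))

  attached-returning : (∀ j → W j ≡ Z j) → ¬ LayerOK Z
  attached-returning W≗Z (one , _) =
    one ( twoColours-≡ (attached zero) u≢Z₀ u≢Z₁
        , twoColours-≡ (attached (suc zero)) v≢Z₁ v≢Z₂ )
    where
    u≢Z₀ = twoColours-≢ (sym (W≗Z zero)) (attached (suc (suc zero)))
    v≢Z₁ = twoColours-≢ (sym (W≗Z (suc zero))) (attached (suc (suc (suc zero))))
    u≢Z₁ = twoColours-≢ (sym (W≗Z (suc zero))) (attached (suc (suc (suc (suc zero)))))
    v≢Z₂ = twoColours-≢ (sym (W≗Z (suc (suc zero)))) (attached (suc (suc (suc (suc (suc zero))))))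

parity : ℕ → Bool
parity zero    = false
parity (suc n) = not (parity n)

parity-double : ∀ m → parity (m + m) ≡ false
parity-double zero    = refl
parity-double (suc m) = begin
  parity (suc m + suc m)        ≡⟨ cong (not ∘ parity) (+-suc m m) ⟩
  not (not (parity (m + m)))    ≡⟨ not-involutive _ ⟩
  parity (m + m)                ≡⟨ parity-double m ⟩
  false                         ∎
  where open ≡-Reasoning

parity-2* : ∀ m → parity (2 * m) ≡ false
parity-2* m = trans (cong (λ n → parity (m + n)) (+-identityʳ m)) (parity-double m)

record ProperLayers (d : ℕ) (h : ℕ → Layer) (u v : ℕ) : Set where
  field
    layers    : ∀ n → n < d → LayerOK (h (suc n))
    crossings : ∀ n → n < d → Crossing (h n) (h (suc n))
    attached  : Attached (h zero) (h d) u v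

module _ {d h u v} (proper : ProperLayers d h u v) where
  open ProperLayers proper

  avoids-along : ∀ {c} → Monochrome c (h zero) → ∀ n → n < d → Avoids c (h (suc n))
  avoids-along mono zero    0<d   = crossing-from-monochrome (crossings zero 0<d) mono
  avoids-along mono (suc n) n+1<d =
    crossing-avoids (crossings (suc n) n+1<d) (layers n n<d) (avoids-along mono n n<d)
    where n<d = ≤-trans (n≤1+n _) n+1<d

  layerOK-from : LayerOK (h zero) → ∀ n → n ≤ d → LayerOK (h n)
  layerOK-from ok zero    _   = ok
  layerOK-from ok (suc n) n<d = layers n n<d

  returns-along : ∀ {a b} → Palette a b (h zero) → LayerOK (h zero) →
                  ∀ n → parity n ≡ false → n ≤ d → ∀ j → h n j ≡ h zero j
  returns-along pal ok zero          _    _     j = refl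
  returns-along pal ok (suc (suc n)) even n+2≤d j =
    trans (crossing-twice palₙ okₙ (crossings n n<d) (layers n n<d) (crossings (suc n) n+2≤d) (layers (suc n) n+2≤d) j)
          (hₙ≗Z j)
    where
    n<d = ≤-trans (n≤1+n _) n+2≤d
    hₙ≗Z = returns-along pal ok n (trans (sym (not-involutive _)) even) (<⇒≤ n<d)
    palₙ = λ j → subst (OneOf _ _) (sym (hₙ≗Z j)) (pal j)
    okₙ = layerOK-from ok n (<⇒≤ n<d)

proper-layers-impossible : ∀ {d h u v} → 0 < d → parity d ≡ false → ¬ ProperLayers d h u v
proper-layers-impossible {suc d} {h} 0<d even proper
  with colour-trichotomy {h zero zero} {h zero (suc zero)} {h zero (suc (suc zero))}
... | inj₁ (x₀≡x₁ , x₁≡x₂) =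
  attached-monochrome attached mono (avoids-along proper mono d ≤-refl) (layers d ≤-refl)
  where
  open ProperLayers proper
  mono : Monochrome (h zero zero) (h zero)
  mono zero             = refl
  mono (suc zero)       = sym x₀≡x₁
  mono (suc (suc zero)) = sym (trans x₀≡x₁ x₁≡x₂)
... | inj₂ (inj₁ (x₀≢x₁ , x₁≢x₂ , x₀≢x₂)) =
  layerOK⇒¬rainbow (layers zero 0<d) λ j≢j′ h₁j≡h₁j′ →
    rainbow j≢j′ (trans (sym (same _)) (trans h₁j≡h₁j′ (same _)))
  where
  open ProperLayers proper
  rainbow = distinct⇒rainbow x₀≢x₁ x₁≢x₂ x₀≢x₂
  same = crossing-from-rainbow (crossings zero 0<d) rainbow
... | inj₂ (inj₂ ok) =
  let a , b , pal = layerOK⇒palette ok in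
  attached-returning attached (returns-along proper pal ok (suc d) even ≤-refl) ok
  where open ProperLayers proper

shift : Fin 2 → Fin 3 → Fin 3
shift zero       j = next j
shift (suc zero) j = next (next j)

shift-≢ : ∀ t j → j ≢ shift t j
shift-≢ zero       zero             ()
shift-≢ zero       (suc zero)       ()
shift-≢ zero       (suc (suc zero)) ()
shift-≢ (suc zero) zero             ()
shift-≢ (suc zero) (suc zero)       ()
shift-≢ (suc zero) (suc (suc zero)) ()

shift-onto : ∀ {j j′} → j ≢ j′ → ∃ λ t → shift t j ≡ j′
shift-onto {zero}           {zero}           j≢j′ = ⊥-elim (j≢j′ refl)
shift-onto {zero}           {suc zero}       _    = zero , refl
shift-onto {zero}           {suc (suc zero)} _    = suc zero , refl
shift-onto {suc zero}       {zero}           _    = suc zero , refl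
shift-onto {suc zero}       {suc zero}       j≢j′ = ⊥-elim (j≢j′ refl)
shift-onto {suc zero}       {suc (suc zero)} _    = zero , refl
shift-onto {suc (suc zero)} {zero}           _    = zero , refl
shift-onto {suc (suc zero)} {suc zero}       _    = suc zero , refl
shift-onto {suc (suc zero)} {suc (suc zero)} j≢j′ = ⊥-elim (j≢j′ refl)

CrossOK : Layer → Layer → Fin 3 → Fin 2 → Set
CrossOK X Y j t = TwoColours (Y j) (X j) (X (shift t j))

crossing⇒crossOK : ∀ {X Y} → Crossing X Y → ∀ j t → CrossOK X Y j t
crossing⇒crossOK cross j t = cross (shift-≢ t j)

crossOK⇒crossing : ∀ {X Y} → (∀ j t → CrossOK X Y j t) → Crossing X Y
crossOK⇒crossing {X} {Y} ok {j} j≢j′ =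
  let t , shift≡j′ = shift-onto j≢j′ in subst (TwoColours (Y j) (X j) ∘ X) shift≡j′ (ok j t)

-- Layer n is V_{n+1} of the paper.  The edge layer i is V_{i+2} (V₁ is not an edge), cross q j t is
-- {v_{q+2,j}, v_{q+1,j}, v_{q+1,j+t+1}}, and attach i are the six edges through u and v.
Label : ℕ → Set
Label k = Fin (2 * k) ⊎ (Fin (2 * k) × Fin 3 × Fin 2) ⊎ Fin 6

pattern layer i     = inj₁ i
pattern cross q j t = inj₂ (inj₁ (q , j , t))
pattern attach i    = inj₂ (inj₂ i)

label-≟ : ∀ k → DecidableEquality (Label k)
label-≟ k = ≡-dec _≟ᶠ_ (≡-dec (×-≡-dec _≟ᶠ_ (×-≡-dec _≟ᶠ_ _≟ᶠ_)) _≟ᶠ_)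

firstLayer lastLayer : ∀ k → Fin 3 → Fin (N k)
firstLayer k = vtx k zero
lastLayer  k = vtx k (fromℕ (2 * k))

edgeSet : ∀ k → Label k → Subset (N k)
edgeSet k (layer i)     = triple (vtx k (suc i) zero) (vtx k (suc i) (suc zero)) (vtx k (suc i) (suc (suc zero)))
edgeSet k (cross q j t) = triple (vtx k (suc q) j) (vtx k (inject₁ q) j) (vtx k (inject₁ q) (shift t j))
edgeSet k (attach zero)             = triple (uV k) (firstLayer k zero) (firstLayer k (suc zero))
edgeSet k (attach (suc zero))       = triple (vV k) (firstLayer k (suc zero)) (firstLayer k (suc (suc zero)))
edgeSet k (attach (suc (suc zero))) = triple (uV k) (firstLayer k zero) (lastLayer k zero)
edgeSet k (attach (suc (suc (suc zero))))             = triple (vV k) (firstLayer k (suc zero)) (lastLayer k (suc zero))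
edgeSet k (attach (suc (suc (suc (suc zero)))))       = triple (uV k) (firstLayer k (suc zero)) (lastLayer k (suc zero))
edgeSet k (attach (suc (suc (suc (suc (suc zero)))))) = triple (vV k) (firstLayer k (suc (suc zero))) (lastLayer k (suc (suc zero)))

Satisfies : ∀ k → (ℕ → Layer) → ℕ → ℕ → Label k → Set
Satisfies k h u v (layer i)     = LayerOK (h (suc (toℕ i)))
Satisfies k h u v (cross q j t) = CrossOK (h (toℕ q)) (h (suc (toℕ q))) j t
Satisfies k h u v (attach i)    = AttachOK i (h zero) (h (2 * k)) u v

satisfies⇒proper : ∀ {k h u v} → (∀ p → Satisfies k h u v p) → ProperLayers (2 * k) h u v
satisfies⇒proper {k} {h} sat = record
  { layers    = λ n n<2k → subst (λ m → LayerOK (h (suc m))) (toℕ-fromℕ< n<2k) (sat (layer (fromℕ< n<2k)))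
  ; crossings = λ n n<2k → subst (λ m → Crossing (h m) (h (suc m))) (toℕ-fromℕ< n<2k)
                  (crossOK⇒crossing λ j t → sat (cross (fromℕ< n<2k) j t))
  ; attached  = λ i → sat (attach i)
  }

module _ (k : ℕ) where

  vtx-injective : ∀ {i i′ j j′} → vtx k i j ≡ vtx k i′ j′ → i ≡ i′ × j ≡ j′
  vtx-injective {i} {i′} {j} {j′} eq =
    combine-injective i j i′ j′ (↑ˡ-injective 2 (combine i j) (combine i′ j′) eq)

  hub≢vtx : ∀ s {i j} → K k * 3 ↑ʳ s ≢ vtx k i j
  hub≢vtx s {i} {j} eq
    with trans (sym (splitAt-↑ʳ (K k * 3) 2 s)) (trans (cong (splitAt (K k * 3)) eq) (splitAt-↑ˡ (K k * 3) (combine i j) 2))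
  ... | ()

  vertex-cases : ∀ x → (∃ λ i → ∃ λ j → x ≡ vtx k i j) ⊎ x ≡ uV k ⊎ x ≡ vV k
  vertex-cases x with splitAt (K k * 3) x | join-splitAt (K k * 3) 2 x
  ... | inj₁ y          | y↑≡x = let i , j = remQuot {K k} 3 y in
    inj₁ (i , j , trans (sym y↑≡x) (cong (_↑ˡ 2) (sym (combine-remQuot {K k} 3 y))))
  ... | inj₂ zero       | u≡x  = inj₂ (inj₁ (sym u≡x))
  ... | inj₂ (suc zero) | v≡x  = inj₂ (inj₂ (sym v≡x))

  fromLayers : (ℕ → Layer) → ℕ → ℕ → Fin (N k) → ℕ
  fromLayers h u v = [ layerColour , hubColour ]′ ∘ splitAt (K k * 3)
    where
    layerColour : Fin (K k * 3) → ℕ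
    layerColour y = uncurry (h ∘ toℕ) (remQuot {K k} 3 y)
    hubColour : Fin 2 → ℕ
    hubColour zero    = u
    hubColour (suc _) = v

  module _ (h : ℕ → Layer) (u v : ℕ) where

    fromLayers-vtx : ∀ i j → fromLayers h u v (vtx k i j) ≡ h (toℕ i) j
    fromLayers-vtx i j rewrite splitAt-↑ˡ (K k * 3) (combine i j) 2 =
      cong (uncurry (h ∘ toℕ)) (remQuot-combine {K k} {3} i j)

    fromLayers-u : fromLayers h u v (uV k) ≡ u
    fromLayers-u rewrite splitAt-↑ʳ (K k * 3) 2 zero = refl

    fromLayers-v : fromLayers h u v (vV k) ≡ v
    fromLayers-v rewrite splitAt-↑ʳ (K k * 3) 2 (suc zero) = refl

  -- Beyond the last layer the value 0 is junk; only layers 0, …, 2k are ever inspected.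
  toLayers : (Fin (N k) → ℕ) → ℕ → Layer
  toLayers f n j with n <? K k
  ... | yes n<K = f (vtx k (fromℕ< n<K) j)
  ... | no  _   = 0

  toLayers-vtx : ∀ f i j → f (vtx k i j) ≡ toLayers f (toℕ i) j
  toLayers-vtx f i j with toℕ i <? K k
  ... | yes i<K = cong (λ i → f (vtx k i j)) (sym (fromℕ<-toℕ i i<K))
  ... | no  i≮K = ⊥-elim (i≮K (toℕ<n i))

module _ (k′ : ℕ) where

  private
    k : ℕ
    k = suc k′

    layers≢ : ∀ {i i′} j j′ → i ≢ i′ → vtx k i j ≢ vtx k i′ j′
    layers≢ {i} {i′} j j′ i≢i′ = i≢i′ ∘ proj₁ ∘ vtx-injective k {i} {i′} {j} {j′}

    positions≢ : ∀ i j j′ → j ≢ j′ → vtx k i j ≢ vtx k i j′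
    positions≢ i j j′ j≢j′ = j≢j′ ∘ proj₂ ∘ vtx-injective k {i} {i} {j} {j′}

    hub≢ : ∀ s i j → K k * 3 ↑ʳ s ≢ vtx k i j
    hub≢ s i j = hub≢vtx k s {i} {j}

    suc≢inject₁ : ∀ {c} (q : Fin c) → suc q ≢ inject₁ q
    suc≢inject₁ q eq = 1+n≢n {toℕ q} (trans (cong toℕ eq) (toℕ-inject₁ q))

    first≢last : zero ≢ fromℕ (2 * k)
    first≢last ()

  module _ (f : Fin (N k) → ℕ) (h : ℕ → Layer) (f≗h : ∀ i j → f (vtx k i j) ≡ h (toℕ i) j) where

    private
      triple⇔ : ∀ a b c {x y z} → a ≢ b → b ≢ c → a ≢ c → f a ≡ x → f b ≡ y → f c ≡ z →
                GoodOn f (triple a b c) ⇔ TwoColours x y z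
      triple⇔ a b c a≢b b≢c a≢c refl refl refl = goodOn-triple⇔ f a b c a≢b b≢c a≢c

      inject≗ : ∀ q j → f (vtx k (inject₁ q) j) ≡ h (toℕ q) j
      inject≗ q j = trans (f≗h _ j) (cong (λ n → h n j) (toℕ-inject₁ q))

      last≗ : ∀ j → f (lastLayer k j) ≡ h (2 * k) j
      last≗ j = trans (f≗h _ j) (cong (λ n → h n j) (toℕ-fromℕ (2 * k)))

    goodOn⇔satisfies : ∀ p → GoodOn f (edgeSet k p) ⇔ Satisfies k h (f (uV k)) (f (vV k)) p
    goodOn⇔satisfies (layer i) =
      triple⇔ (vtx k (suc i) zero) (vtx k (suc i) (suc zero)) (vtx k (suc i) (suc (suc zero)))
              (positions≢ (suc i) zero (suc zero) (λ ())) (positions≢ (suc i) (suc zero) (suc (suc zero)) (λ ()))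
              (positions≢ (suc i) zero (suc (suc zero)) (λ ())) (f≗h _ _) (f≗h _ _) (f≗h _ _)
    goodOn⇔satisfies (cross q j t) =
      triple⇔ (vtx k (suc q) j) (vtx k (inject₁ q) j) (vtx k (inject₁ q) (shift t j))
              (layers≢ j j (suc≢inject₁ q)) (positions≢ (inject₁ q) j (shift t j) (shift-≢ t j))
              (layers≢ j (shift t j) (suc≢inject₁ q)) (f≗h _ _) (inject≗ q j) (inject≗ q (shift t j))
    goodOn⇔satisfies (attach zero) =
      triple⇔ (uV k) (firstLayer k zero) (firstLayer k (suc zero))
              (hub≢ zero zero zero) (positions≢ zero zero (suc zero) (λ ())) (hub≢ zero zero (suc zero))
              refl (f≗h _ _) (f≗h _ _)
    goodOn⇔satisfies (attach (suc zero)) =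
      triple⇔ (vV k) (firstLayer k (suc zero)) (firstLayer k (suc (suc zero)))
              (hub≢ (suc zero) zero (suc zero)) (positions≢ zero (suc zero) (suc (suc zero)) (λ ()))
              (hub≢ (suc zero) zero (suc (suc zero))) refl (f≗h _ _) (f≗h _ _)
    goodOn⇔satisfies (attach (suc (suc zero))) =
      triple⇔ (uV k) (firstLayer k zero) (lastLayer k zero)
              (hub≢ zero zero zero) (layers≢ zero zero first≢last) (hub≢ zero (fromℕ (2 * k)) zero)
              refl (f≗h _ _) (last≗ _)
    goodOn⇔satisfies (attach (suc (suc (suc zero)))) =
      triple⇔ (vV k) (firstLayer k (suc zero)) (lastLayer k (suc zero))
              (hub≢ (suc zero) zero (suc zero)) (layers≢ (suc zero) (suc zero) first≢last)
              (hub≢ (suc zero) (fromℕ (2 * k)) (suc zero))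
              refl (f≗h _ _) (last≗ _)
    goodOn⇔satisfies (attach (suc (suc (suc (suc zero))))) =
      triple⇔ (uV k) (firstLayer k (suc zero)) (lastLayer k (suc zero))
              (hub≢ zero zero (suc zero)) (layers≢ (suc zero) (suc zero) first≢last)
              (hub≢ zero (fromℕ (2 * k)) (suc zero))
              refl (f≗h _ _) (last≗ _)
    goodOn⇔satisfies (attach (suc (suc (suc (suc (suc zero)))))) =
      triple⇔ (vV k) (firstLayer k (suc (suc zero))) (lastLayer k (suc (suc zero)))
              (hub≢ (suc zero) zero (suc (suc zero))) (layers≢ (suc (suc zero)) (suc (suc zero)) first≢last)
              (hub≢ (suc zero) (fromℕ (2 * k)) (suc (suc zero))) refl (f≗h _ _) (last≗ _)

palette-avoids : ∀ {a b c X} → Palette a b X → a ≢ c → b ≢ c → Avoids c X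
palette-avoids pal a≢c b≢c j Xj≡c with pal j
... | inj₁ Xj≡a = a≢c (trans (sym Xj≡a) Xj≡c)
... | inj₂ Xj≡b = b≢c (trans (sym Xj≡b) Xj≡c)

Pattern : Set
Pattern = Fin 3 → Bool

NonConstant : Pattern → Set
NonConstant F = ¬ (F zero ≡ F (suc zero) × F (suc zero) ≡ F (suc (suc zero)))

paint : ℕ → ℕ → Pattern → Layer
paint a b F j = if F j then b else a

alternate : ℕ → Pattern → Pattern
alternate n F j = parity n xor F j

single : Fin 3 → Pattern
single p j = does (j ≟ᶠ p)

single-nonConstant : ∀ p → NonConstant (single p)
single-nonConstant zero             (() , _)
single-nonConstant (suc zero)       (() , _)
single-nonConstant (suc (suc zero)) (_ , ())

alternate-nonConstant : ∀ n F → NonConstant F → NonConstant (alternate n F)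
alternate-nonConstant n F nc (e₁ , e₂) = nc (xor-cancel e₁ , xor-cancel e₂)
  where
  xor-cancel : ∀ {x y} → parity n xor x ≡ parity n xor y → x ≡ y
  xor-cancel {x} {y} eq with parity n
  ... | false = eq
  ... | true  = not-injective eq

alternate-flips : ∀ n F j → alternate (suc n) F j ≢ alternate n F j
alternate-flips n F j with parity n | F j
... | false | false = λ ()
... | false | true  = λ ()
... | true  | false = λ ()
... | true  | true  = λ ()

module _ {a b : ℕ} (a≢b : a ≢ b) where

  paint-palette : ∀ F → Palette a b (paint a b F)
  paint-palette F j with F j
  ... | false = inj₁ refl
  ... | true  = inj₂ refl

  paint-injective : ∀ {x y} → (if x then b else a) ≡ (if y then b else a) → x ≡ y
  paint-injective {false} {false} _   = refl
  paint-injective {false} {true}  a≡b = ⊥-elim (a≢b a≡b)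
  paint-injective {true}  {false} b≡a = ⊥-elim (a≢b (sym b≡a))
  paint-injective {true}  {true}  _   = refl

  paint-layerOK : ∀ F → NonConstant F → LayerOK (paint a b F)
  paint-layerOK F nc = oneOf⇒twoColours (paint-palette F _) (paint-palette F _) (paint-palette F _)
    λ (e₁ , e₂) → nc (paint-injective e₁ , paint-injective e₂)

  paint-crossing : ∀ {F G} → (∀ j → G j ≢ F j) → Crossing (paint a b F) (paint a b G)
  paint-crossing {F} {G} G≢F {j} _ = oneOf⇒twoColours (paint-palette G j) (paint-palette F j) (paint-palette F _)
    λ (e , _) → G≢F j (paint-injective e)

  alternating-layerOK : ∀ n p → LayerOK (paint a b (alternate n (single p)))
  alternating-layerOK n p = paint-layerOK (alternate n (single p)) (alternate-nonConstant n (single p) (single-nonConstant p))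

  alternating-crossing : ∀ n F → Crossing (paint a b (alternate n F)) (paint a b (alternate (suc n) F))
  alternating-crossing n F = paint-crossing (alternate-flips n F)

  alternating-avoids : ∀ {c} → a ≢ c → b ≢ c → ∀ n F → Avoids c (paint a b (alternate n F))
  alternating-avoids a≢c b≢c n F = palette-avoids (paint-palette (alternate n F)) a≢c b≢c

attached-from-zero : ∀ {x W} → x ≢ 0 → Palette 0 x W → Attached (λ _ → 0) W x x
attached-from-zero {x} {W} x≢0 pal = λ
  { zero                                → through (inj₁ refl)
  ; (suc zero)                          → through (inj₁ refl)
  ; (suc (suc zero))                    → through (pal zero)
  ; (suc (suc (suc zero)))              → through (pal (suc zero))
  ; (suc (suc (suc (suc zero))))        → through (pal (suc zero))
  ; (suc (suc (suc (suc (suc zero))))) → through (pal (suc (suc zero)))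
  }
  where
  through : ∀ {y} → OneOf 0 x y → TwoColours x 0 y
  through y∈ = oneOf⇒twoColours (inj₂ refl) (inj₁ refl) y∈ (x≢0 ∘ proj₁)

_◂_ : Layer → (ℕ → Layer) → ℕ → Layer
(Z ◂ L) zero    = Z
(Z ◂ L) (suc n) = L n

attachOK? : ∀ i Z W u v → Dec (AttachOK i Z W u v)
attachOK? zero                                Z W u v = twoColours? _ _ _
attachOK? (suc zero)                          Z W u v = twoColours? _ _ _
attachOK? (suc (suc zero))                    Z W u v = twoColours? _ _ _
attachOK? (suc (suc (suc zero)))              Z W u v = twoColours? _ _ _
attachOK? (suc (suc (suc (suc zero))))        Z W u v = twoColours? _ _ _
attachOK? (suc (suc (suc (suc (suc zero))))) Z W u v = twoColours? _ _ _

-- When the deleted edge is a crossing out of layer 0 or passes through u or v, the rest is coloured by a suitable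
-- layer 0 followed by layers alternating in a two-colour palette; the tables below were found by search and are
-- checked by evaluation.
record Seed : Set where
  constructor seed
  field
    start         : Layer
    colourA colourB : ℕ
    point         : Fin 3
    colourU colourV : ℕ

  second final : Layer
  second = paint colourA colourB (single point)
  final  = paint colourA colourB (not ∘ single point)

open Seed

layer³ : ℕ → ℕ → ℕ → Layer
layer³ x y z zero             = x
layer³ x y z (suc zero)       = y
layer³ x y z (suc (suc zero)) = z

FirstCrossingSeed : Fin 3 → Fin 2 → Seed → Set
FirstCrossingSeed j₀ t₀ s =
  colourA s ≢ colourB s × (∀ j t → (j , t) ≢ (j₀ , t₀) → CrossOK (start s) (second s) j t) ×
  Attached (start s) (final s) (colourU s) (colourV s)

AttachmentSeed : Fin 6 → Seed → Set
AttachmentSeed i₀ s =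
  colourA s ≢ colourB s × (∀ j t → CrossOK (start s) (second s) j t) ×
  (∀ i → i ≢ i₀ → AttachOK i (start s) (final s) (colourU s) (colourV s))

firstCrossingSeed : Fin 3 → Fin 2 → Seed
firstCrossingSeed zero             zero       = seed (layer³ 0 0 1) 1 0 zero             1 1
firstCrossingSeed zero             (suc zero) = seed (layer³ 0 1 0) 1 0 zero             0 1
firstCrossingSeed (suc zero)       zero       = seed (layer³ 0 1 1) 0 1 (suc zero)       0 0
firstCrossingSeed (suc zero)       (suc zero) = seed (layer³ 0 0 1) 0 1 zero             1 0
firstCrossingSeed (suc (suc zero)) zero       = seed (layer³ 0 1 0) 1 0 (suc (suc zero)) 1 0
firstCrossingSeed (suc (suc zero)) (suc zero) = seed (layer³ 0 1 1) 0 1 (suc (suc zero)) 0 0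

attachmentSeed : Fin 6 → Seed
attachmentSeed zero                                = seed (layer³ 0 0 0) 1 2 zero             0 2
attachmentSeed (suc zero)                          = seed (layer³ 0 0 0) 1 2 (suc (suc zero)) 2 0
attachmentSeed (suc (suc zero))                    = seed (layer³ 0 0 0) 1 2 zero             2 2
attachmentSeed (suc (suc (suc zero)))              = seed (layer³ 0 0 0) 1 2 (suc (suc zero)) 2 1
attachmentSeed (suc (suc (suc (suc zero))))        = seed (layer³ 0 0 0) 1 2 zero             1 2
attachmentSeed (suc (suc (suc (suc (suc zero))))) = seed (layer³ 0 0 0) 1 2 (suc (suc zero)) 2 2

firstCrossingSeed-ok : ∀ j₀ t₀ → FirstCrossingSeed j₀ t₀ (firstCrossingSeed j₀ t₀)
firstCrossingSeed-ok = toWitness {a? = all? λ j₀ → all? λ t₀ → check j₀ t₀ (firstCrossingSeed j₀ t₀)} _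
  where
  check : ∀ j₀ t₀ s → Dec (FirstCrossingSeed j₀ t₀ s)
  check j₀ t₀ s =
    ¬? (colourA s ≟ colourB s) ×-dec
    (all? λ j → all? λ t → ¬? (×-≡-dec _≟ᶠ_ _≟ᶠ_ (j , t) (j₀ , t₀)) →-dec twoColours? _ _ _) ×-dec
    all? λ i → attachOK? i _ _ _ _

attachmentSeed-ok : ∀ i₀ → AttachmentSeed i₀ (attachmentSeed i₀)
attachmentSeed-ok = toWitness {a? = all? λ i₀ → check i₀ (attachmentSeed i₀)} _
  where
  check : ∀ i₀ s → Dec (AttachmentSeed i₀ s)
  check i₀ s =
    ¬? (colourA s ≟ colourB s) ×-dec
    (all? λ j → all? λ t → twoColours? _ _ _) ×-dec
    all? λ i → ¬? (i ≟ᶠ i₀) →-dec attachOK? i _ _ _ _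

AllBut : ∀ k → Label k → (ℕ → Layer) → ℕ → ℕ → Set
AllBut k p h u v = ∀ q → q ≢ p → Satisfies k h u v q

-- 2 * suc k′ reduces to suc (top k′), so the last layer of Z ◂ L is L (top k′).
top : ℕ → ℕ
top k′ = k′ + suc (k′ + 0)

parity-top : ∀ k′ → parity (top k′) ≡ true
parity-top k′ = trans (sym (not-involutive _)) (cong not (parity-2* (suc k′)))

module Seeded (k′ : ℕ) (s : Seed) (a≢b : colourA s ≢ colourB s) where

  layers : ℕ → Layer
  layers = start s ◂ λ n → paint (colourA s) (colourB s) (alternate n (single (point s)))

  seeded-allBut : ∀ p → (∀ j t → cross zero j t ≢ p → CrossOK (start s) (second s) j t) →
                  (∀ i → attach i ≢ p → AttachOK i (start s) (final s) (colourU s) (colourV s)) →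
                  AllBut (suc k′) p layers (colourU s) (colourV s)
  seeded-allBut p first last (layer i) _ =
    alternating-layerOK a≢b (toℕ i) (point s)
  seeded-allBut p first last (cross zero j t)    q≢p = first j t q≢p
  seeded-allBut p first last (cross (suc q) j t) _   =
    crossing⇒crossOK (alternating-crossing a≢b (toℕ q) (single (point s))) j t
  seeded-allBut p first last (attach i) q≢p =
    subst (λ b → AttachOK i (start s) (paint (colourA s) (colourB s) (λ j → b xor single (point s) j)) _ _)
          (sym (parity-top k′)) (last i q≢p)

splice : ℕ → (ℕ → Layer) → (ℕ → Layer) → ℕ → Layer
splice c A B n with n <? c
... | yes _ = A n
... | no  _ = B (n ∸ c)

module Splice (c : ℕ) (A B : ℕ → Layer) where

  splice-< : ∀ {n} → n < c → splice c A B n ≡ A n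
  splice-< {n} n<c with n <? c
  ... | yes _   = refl
  ... | no  n≮c = ⊥-elim (n≮c n<c)

  splice-≥ : ∀ {n} → c ≤ n → splice c A B n ≡ B (n ∸ c)
  splice-≥ {n} c≤n with n <? c
  ... | yes n<c = ⊥-elim (<⇒≱ n<c c≤n)
  ... | no  _   = refl

  splice-cases : ∀ {P : Layer → Set} n → (n < c → P (A n)) → (c ≤ n → P (B (n ∸ c))) → P (splice c A B n)
  splice-cases {P} n inA inB with n <? c
  ... | yes n<c = inA n<c
  ... | no  n≮c = inB (≮⇒≥ n≮c)

  splice-step : ∀ {R : Layer → Layer → Set} m →
                (suc m < c → R (A m) (A (suc m))) → (suc m ≡ c → R (A m) (B 0)) →
                (c ≤ m → R (B (m ∸ c)) (B (suc (m ∸ c)))) → R (splice c A B m) (splice c A B (suc m))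
  splice-step {R} m inA junction inB with <-cmp (suc m) c
  ... | tri< m+1<c _ _ = subst₂ R (sym (splice-< (<-trans (n<1+n m) m+1<c))) (sym (splice-< m+1<c)) (inA m+1<c)
  ... | tri≈ _ refl _  = subst₂ R (sym (splice-< (n<1+n m))) (sym (splice-≥ ≤-refl))
                                (subst (R (A m) ∘ B) (sym (n∸n≡0 (suc m))) (junction refl))
  ... | tri> _ _ c<m+1 = subst₂ R (sym (splice-≥ c≤m)) (sym (splice-≥ (m≤n⇒m≤1+n c≤m)))
                                (subst (R (B (m ∸ c)) ∘ B) (sym (+-∸-assoc 1 c≤m)) (inB c≤m))
    where c≤m = ≤-pred c<m+1

parity-junction : ∀ m c → suc m ≡ c → parity (suc m + c) ≡ false
parity-junction m c refl = parity-double (suc m)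

junction-crossing : ∀ j₀ t₀ j t → (j , t) ≢ (j₀ , t₀) →
                    CrossOK (paint 1 2 (single (shift t₀ j₀))) (paint 2 0 (single j₀)) j t
junction-crossing = toWitness {a? = all? λ j₀ → all? λ t₀ → all? λ j → all? λ t → check j₀ t₀ j t} _
  where
  check : ∀ j₀ t₀ j t → Dec ((j , t) ≢ (j₀ , t₀) →
                              CrossOK (paint 1 2 (single (shift t₀ j₀))) (paint 2 0 (single j₀)) j t)
  check j₀ t₀ j t = ¬? (×-≡-dec _≟ᶠ_ _≟ᶠ_ (j , t) (j₀ , t₀)) →-dec twoColours? _ _ _

-- After a monochromatic layer 0 the layers alternate in the colours {1, 2} up to layer c and in {0, 2} afterwards;
-- the parities make the two patterns meeting at the deleted crossing those of junction-crossing.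
module SkipCrossing (k′ : ℕ) (q₀ : Fin (top k′)) (j₀ : Fin 3) (t₀ : Fin 2) where

  private
    c : ℕ
    c = suc (toℕ q₀)

    F G : Pattern
    F = single (shift t₀ j₀)
    G = single j₀

    A B : ℕ → Layer
    A m = paint 1 2 (alternate (suc m + c) F)
    B x = paint 2 0 (alternate x G)

    open Splice c A B

  layers : ℕ → Layer
  layers = (λ _ → 0) ◂ splice c A B

  skipCrossing-allBut : AllBut (suc k′) (cross (suc q₀) j₀ t₀) layers 2 2
  skipCrossing-allBut (layer i) _ = splice-cases {P = LayerOK} (toℕ i)
    (λ _ → alternating-layerOK (λ ()) (suc (toℕ i) + c) (shift t₀ j₀))
    (λ _ → alternating-layerOK (λ ()) (toℕ i ∸ c) j₀)
  skipCrossing-allBut (cross zero j t) _ =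
    crossing⇒crossOK (monochrome-crossing (subst (Avoids 0) (sym (splice-< (s≤s z≤n)))
                                                  (alternating-avoids (λ ()) (λ ()) (λ ()) (suc c) F))) j t
  skipCrossing-allBut (cross (suc q) j t) q≢p =
    splice-step {R = λ X Y → CrossOK X Y j t} (toℕ q)
      (λ _ → crossing⇒crossOK (alternating-crossing (λ ()) (suc (toℕ q) + c) F) j t)
      junction
      (λ _ → crossing⇒crossOK (alternating-crossing (λ ()) (toℕ q ∸ c) G) j t)
    where
    junction : suc (toℕ q) ≡ c → CrossOK (A (toℕ q)) (B 0) j t
    junction q+1≡c = subst (λ b → CrossOK (paint 1 2 (λ i → b xor F i)) (B 0) j t)
                           (sym (parity-junction (toℕ q) c q+1≡c))
                           (junction-crossing j₀ t₀ j t λ { refl →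
                             q≢p (cong (λ q → cross (suc q) j₀ t₀) q≡q₀) })
      where q≡q₀ = toℕ-injective (suc-injective q+1≡c)
  skipCrossing-allBut (attach i) _ =
    subst (λ W → AttachOK i (λ _ → 0) W 2 2) (sym (splice-≥ (toℕ<n q₀)))
          (attached-from-zero (λ ()) (Sum.swap ∘ paint-palette (λ ()) (alternate (top k′ ∸ c) G)) i)

junction-to-monochrome : ∀ j t → CrossOK (paint 1 2 (single zero)) (λ _ → 2) j t
junction-to-monochrome = toWitness {a? = all? λ j → all? λ t → twoColours? _ _ _} _

-- As in SkipCrossing, but the deleted layer c + 1 is monochromatic 2 and the layers after it alternate in {0, 3}.
module SkipLayer (k′ : ℕ) (i₀ : Fin (2 * suc k′)) where

  private
    c : ℕ
    c = toℕ i₀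

    F : Pattern
    F = single zero

    A B : ℕ → Layer
    A m       = paint 1 2 (alternate (suc m + c) F)
    B zero    = λ _ → 2
    B (suc x) = paint 0 3 (alternate x F)

    hubColour : ℕ → ℕ
    hubColour zero    = 2
    hubColour (suc _) = 3

    B-palette : ∀ x → Palette 0 (hubColour x) (B x)
    B-palette zero    _ = inj₂ refl
    B-palette (suc x)   = paint-palette (λ ()) (alternate x F)

    B-layerOK : ∀ x → x ≢ 0 → LayerOK (B x)
    B-layerOK zero    x≢0 = ⊥-elim (x≢0 refl)
    B-layerOK (suc x) _   = alternating-layerOK (λ ()) x zero

    B-crossing : ∀ x → Crossing (B x) (B (suc x))
    B-crossing zero    = monochrome-crossing (alternating-avoids (λ ()) (λ ()) (λ ()) 0 F)
    B-crossing (suc x) = alternating-crossing (λ ()) x F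

    open Splice c A B

  layers : ℕ → Layer
  layers = (λ _ → 0) ◂ splice c A B

  hub : ℕ
  hub = hubColour (top k′ ∸ c)

  skipLayer-allBut : AllBut (suc k′) (layer i₀) layers hub hub
  skipLayer-allBut (layer i) i≢i₀ = splice-cases {P = LayerOK} (toℕ i)
    (λ _ → alternating-layerOK (λ ()) (suc (toℕ i) + c) zero)
    (λ c≤i → B-layerOK (toℕ i ∸ c) λ i∸c≡0 →
      i≢i₀ (cong layer (toℕ-injective (≤-antisym (m∸n≡0⇒m≤n i∸c≡0) c≤i))))
  skipLayer-allBut (cross zero j t) _ = crossing⇒crossOK (monochrome-crossing first-avoids) j t
    where
    first-avoids : Avoids 0 (splice c A B 0)
    first-avoids = splice-cases {P = Avoids 0} 0
      (λ _ → alternating-avoids (λ ()) (λ ()) (λ ()) (suc c) F)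
      (λ _ → subst (Avoids 0 ∘ B) (sym (0∸n≡0 c)) (λ _ ()))
  skipLayer-allBut (cross (suc q) j t) _ =
    splice-step {R = λ X Y → CrossOK X Y j t} (toℕ q)
      (λ _ → crossing⇒crossOK (alternating-crossing (λ ()) (suc (toℕ q) + c) F) j t)
      (λ q+1≡c → subst (λ b → CrossOK (paint 1 2 (λ i → b xor F i)) (B 0) j t)
                       (sym (parity-junction (toℕ q) c q+1≡c)) (junction-to-monochrome j t))
      (λ _ → crossing⇒crossOK (B-crossing (toℕ q ∸ c)) j t)
  skipLayer-allBut (attach i) _ =
    subst (λ W → AttachOK i (λ _ → 0) W hub hub) (sym (splice-≥ (toℕ≤pred[n] i₀)))
          (attached-from-zero (hubColour≢0 (top k′ ∸ c)) (B-palette (top k′ ∸ c)) i)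
    where
    hubColour≢0 : ∀ x → hubColour x ≢ 0
    hubColour≢0 zero    ()
    hubColour≢0 (suc _) ()

layered-allBut : ∀ k′ p → ∃ λ h → ∃ λ u → ∃ λ v → AllBut (suc k′) p h u v
layered-allBut k′ (layer i₀)             = _ , _ , _ , SkipLayer.skipLayer-allBut k′ i₀
layered-allBut k′ (cross (suc q₀) j₀ t₀) = _ , _ , _ , SkipCrossing.skipCrossing-allBut k′ q₀ j₀ t₀
layered-allBut k′ (cross zero j₀ t₀) =
  let a≢b , first , last = firstCrossingSeed-ok j₀ t₀ in
  _ , _ , _ , Seeded.seeded-allBut k′ (firstCrossingSeed j₀ t₀) a≢b (cross zero j₀ t₀)
                (λ j t ne → first j t (ne ∘ cong (λ (j , t) → cross zero j t))) (λ i _ → last i)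
layered-allBut k′ (attach i₀) =
  let a≢b , first , last = attachmentSeed-ok i₀ in
  _ , _ , _ , Seeded.seeded-allBut k′ (attachmentSeed i₀) a≢b (attach i₀)
                (λ j t _ → first j t) (λ i ne → last i (ne ∘ cong attach))

module _ (k′ : ℕ) where

  private
    k = suc k′
    _≟ₗ_ = label-≟ k

  colouring-allBut : ∀ p → ∃ λ f → ∀ q → q ≢ p → GoodOn f (edgeSet k q)
  colouring-allBut p =
    let h , u , v , satisfies = layered-allBut k′ p
        f = fromLayers k h u v
    in f , λ q q≢p → Equivalence.from (goodOn⇔satisfies k′ f h (fromLayers-vtx k h u v) q)
                       (subst₂ (λ u v → Satisfies k h u v q) (sym (fromLayers-u k h u v)) (sym (fromLayers-v k h u v))
                               (satisfies q q≢p))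

  no-good-colouring : ∀ f → ¬ (∀ q → GoodOn f (edgeSet k q))
  no-good-colouring f good =
    proper-layers-impossible (s≤s z≤n) (parity-2* k)
      (satisfies⇒proper {k} {toLayers k f} {f (uV k)} {f (vV k)} λ q →
        Equivalence.to (goodOn⇔satisfies k′ f (toLayers k f) (toLayers-vtx k f) q) (good q))

  -- The colouring that misses only q would also be good on edgeSet q = edgeSet p.
  edgeSet-injective : ∀ {p q} → edgeSet k p ≡ edgeSet k q → p ≡ q
  edgeSet-injective {p} {q} p≡q with p ≟ₗ q
  ... | yes p≡q = p≡q
  ... | no  p≢q = ⊥-elim (no-good-colouring f good-everywhere)
    where
    f = proj₁ (colouring-allBut q)
    good-everywhere : ∀ r → GoodOn f (edgeSet k r)
    good-everywhere r with r ≟ₗ q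
    ... | yes refl = subst (GoodOn f) p≡q (proj₂ (colouring-allBut q) p p≢q)
    ... | no  r≢q  = proj₂ (colouring-allBut q) r r≢q

_⊕_ : ∀ {A B : Set} → List A → List B → List (A ⊎ B)
xs ⊕ ys = map inj₁ xs ++ map inj₂ ys

module _ {A B : Set} {xs : List A} {ys : List B} where

  ∈-⊕ : (∀ a → a ∈ˡ xs) → (∀ b → b ∈ˡ ys) → ∀ s → s ∈ˡ xs ⊕ ys
  ∈-⊕ all-xs _      (inj₁ a) = ∈-++⁺ˡ (∈-map⁺ inj₁ (all-xs a))
  ∈-⊕ _      all-ys (inj₂ b) = ∈-++⁺ʳ (map inj₁ xs) (∈-map⁺ inj₂ (all-ys b))

  ⊕-unique : Unique xs → Unique ys → Unique (xs ⊕ ys)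
  ⊕-unique !xs !ys = Unique.++⁺ (Unique.map⁺ inj₁-injective !xs) (Unique.map⁺ inj₂-injective !ys) disjoint
    where
    disjoint : ∀ {s} → ¬ (s ∈ˡ map inj₁ xs × s ∈ˡ map inj₂ ys)
    disjoint (s∈₁ , s∈₂) with ∈-map⁻ inj₁ s∈₁ | ∈-map⁻ inj₂ s∈₂
    ... | _ , _ , refl | _ , _ , ()


map-⊕ : ∀ {A B C : Set} (f : A ⊎ B → C) xs ys → map f (xs ⊕ ys) ≡ map (f ∘ inj₁) xs ++ map (f ∘ inj₂) ys
map-⊕ f xs ys = trans (map-++ f (map inj₁ xs) (map inj₂ ys)) (sym (cong₂ _++_ (map-∘ xs) (map-∘ ys)))

concatMap≡map-cartesianProduct : ∀ {A B C : Set} {g : A → List C} {f : A × B → C} ys →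
  (∀ x → g x ≡ map (f ∘ (x ,_)) ys) → ∀ xs → concatMap g xs ≡ map f (cartesianProduct xs ys)
concatMap≡map-cartesianProduct         ys g≗ []       = refl
concatMap≡map-cartesianProduct {g = g} {f} ys g≗ (x ∷ xs) = begin
  g x ++ concatMap g xs
    ≡⟨ cong₂ _++_ (g≗ x) (concatMap≡map-cartesianProduct ys g≗ xs) ⟩
  map (f ∘ (x ,_)) ys ++ map f (cartesianProduct xs ys)    ≡⟨ cong (_++ _) (map-∘ ys) ⟩
  map f (map (x ,_) ys) ++ map f (cartesianProduct xs ys)  ≡⟨ map-++ f (map (x ,_) ys) _ ⟨
  map f (cartesianProduct (x ∷ xs) ys)                     ∎
  where open ≡-Reasoning

labels : ∀ k → List (Label k)
labels k = allFin (2 * k) ⊕ (cartesianProduct (allFin (2 * k)) (cartesianProduct (allFin 3) (allFin 2)) ⊕ allFin 6)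

labels-complete : ∀ k p → p ∈ˡ labels k
labels-complete k = ∈-⊕ ∈-allFin (∈-⊕ (λ (q , j , t) → ∈-cartesianProduct⁺ (∈-allFin q)
                                         (∈-cartesianProduct⁺ (∈-allFin j) (∈-allFin t))) ∈-allFin)

labels-unique : ∀ k → Unique (labels k)
labels-unique k = ⊕-unique (Unique.allFin⁺ _) (⊕-unique
  (Unique.cartesianProduct⁺ (Unique.allFin⁺ _) (Unique.cartesianProduct⁺ (Unique.allFin⁺ 3) (Unique.allFin⁺ 2)))
  (Unique.allFin⁺ 6))

edgeList≡map-edgeSet : ∀ k → edgeList k ≡ map (edgeSet k) (labels k)
edgeList≡map-edgeSet k = begin
  layerEdges k ++ crossEdges k ++ newEdges k
    ≡⟨ cong (λ es → layerEdges k ++ es ++ newEdges k)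
            (concatMap≡map-cartesianProduct {f = edgeSet k ∘ inj₂ ∘ inj₁} offsets (λ _ → refl) qs) ⟩
  map (edgeSet k ∘ inj₁) qs ++
  map (edgeSet k ∘ inj₂ ∘ inj₁) crossings ++ map (edgeSet k ∘ inj₂ ∘ inj₂) (allFin 6)
    ≡⟨ cong (map (edgeSet k ∘ inj₁) qs ++_) (map-⊕ (edgeSet k ∘ inj₂) crossings (allFin 6)) ⟨
  map (edgeSet k ∘ inj₁) qs ++ map (edgeSet k ∘ inj₂) (crossings ⊕ allFin 6)
    ≡⟨ map-⊕ (edgeSet k) qs (crossings ⊕ allFin 6) ⟨
  map (edgeSet k) (labels k)
    ∎
  where
  open ≡-Reasoning
  qs = allFin (2 * k)
  offsets = cartesianProduct (allFin 3) (allFin 2)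
  crossings = cartesianProduct qs offsets

lookup-injective : ∀ {A : Set} {xs : List A} → Unique xs → ∀ {i j} → lookup xs i ≡ lookup xs j → i ≡ j
lookup-injective {xs = x ∷ xs} _           {zero}  {zero}  _  = refl
lookup-injective {xs = x ∷ xs} (x∉ ∷ _)    {zero}  {suc j} eq = ⊥-elim (All.lookup x∉ (∈-lookup j) eq)
lookup-injective {xs = x ∷ xs} (x∉ ∷ _)    {suc i} {zero}  eq = ⊥-elim (All.lookup x∉ (∈-lookup i) (sym eq))
lookup-injective {xs = x ∷ xs} (_  ∷ !xs) {suc i} {suc j} eq = cong suc (lookup-injective !xs eq)

missing-or-full : ∀ {d} (p : Subset d) → (∃ λ x → ¬ x ∈ₛ p) ⊎ p ≡ ⊤
missing-or-full {d} p with all? (_∈? p)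
... | yes all∈ = inj₂ (⊆-antisym ⊆⊤ λ {x} _ → all∈ x)
... | no  ¬all = inj₁ (¬∀⟶∃¬ d (_∈ₛ p) (_∈? p) ¬all)

module _ (k′ : ℕ) where

  private
    k : ℕ
    k = suc k′

    H : BiHypergraph
    H = Hlemma k

    edgeSet∈edgeList : ∀ p → edgeSet k p ∈ˡ edgeList k
    edgeSet∈edgeList p =
      subst (edgeSet k p ∈ˡ_) (sym (edgeList≡map-edgeSet k)) (∈-map⁺ (edgeSet k) (labels-complete k p))

  position : Label k → Fin (m H)
  position = Any.index ∘ edgeSet∈edgeList

  edge-position : ∀ p → edge H (position p) ≡ edgeSet k p
  edge-position p = sym (lookup-index (edgeSet∈edgeList p))

  label-of : ∀ e → ∃ λ p → edge H e ≡ edgeSet k p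
  label-of e
    with ∈-map⁻ (edgeSet k) {xs = labels k} (subst (edge H e ∈ˡ_) (edgeList≡map-edgeSet k) (∈-lookup {xs = edgeList k} e))
  ... | p , _ , e≡p = p , e≡p

  edge-injective : ∀ {e e′} → edge H e ≡ edge H e′ → e ≡ e′
  edge-injective = lookup-injective
    (subst Unique (sym (edgeList≡map-edgeSet k)) (Unique.map⁺ (edgeSet-injective k′) (labels-unique k)))

  covered : ∀ x → ∃ λ p → x ∈ₛ edgeSet k p
  covered x with vertex-cases k x
  ... | inj₁ (zero , zero , refl)           = attach zero , ∈-triple₂ (uV k) (firstLayer k zero) (firstLayer k (suc zero))
  ... | inj₁ (zero , suc zero , refl)       = attach zero , ∈-triple₃ (uV k) (firstLayer k zero) (firstLayer k (suc zero))
  ... | inj₁ (zero , suc (suc zero) , refl) =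
    attach (suc zero) , ∈-triple₃ (vV k) (firstLayer k (suc zero)) (firstLayer k (suc (suc zero)))
  ... | inj₁ (suc i , j , refl)             = layer i , in-layer j
    where
    in-layer : ∀ j → vtx k (suc i) j ∈ₛ edgeSet k (layer i)
    in-layer zero             = ∈-triple₁ (vtx k (suc i) zero) (vtx k (suc i) (suc zero)) (vtx k (suc i) (suc (suc zero)))
    in-layer (suc zero)       = ∈-triple₂ (vtx k (suc i) zero) (vtx k (suc i) (suc zero)) (vtx k (suc i) (suc (suc zero)))
    in-layer (suc (suc zero)) = ∈-triple₃ (vtx k (suc i) zero) (vtx k (suc i) (suc zero)) (vtx k (suc i) (suc (suc zero)))
  ... | inj₂ (inj₁ refl) = attach zero , ∈-triple₁ (uV k) (firstLayer k zero) (firstLayer k (suc zero))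
  ... | inj₂ (inj₂ refl) = attach (suc zero) , ∈-triple₁ (vV k) (firstLayer k (suc zero)) (firstLayer k (suc (suc zero)))

  missing-edge : ∀ (S : Subhypergraph H) → IsProper S → ∃ λ e → ¬ e ∈ₛ E' S
  missing-edge S proper with missing-or-full (V' S)
  ... | inj₁ (x , x∉V′) = let p , x∈ = covered x in
    position p , λ p∈E′ → x∉V′ (edges⊆V' S _ p∈E′ (subst (x ∈ₛ_) (sym (edge-position p)) x∈))
  ... | inj₂ V′≡⊤ with missing-or-full (E' S)
  ...   | inj₁ e∉E′ = e∉E′
  ...   | inj₂ E′≡⊤ = ⊥-elim (proper (V′≡⊤ , E′≡⊤))

  uncolourable : ¬ Colorable H
  uncolourable (f , proper) = no-good-colouring k′ f λ p → subst (GoodOn f) (edge-position p) (proper (position p))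

  minimal : ∀ (S : Subhypergraph H) → IsProper S → SubColorable S
  minimal S proper =
    let e , e∉E′ = missing-edge S proper
        p , e≡p = label-of e
        f , good = colouring-allBut k′ p
    in f , λ e′ e′∈E′ →
      let p′ , e′≡p′ = label-of e′ in
      subst (GoodOn f) (sym e′≡p′) (good p′ λ p′≡p →
        e∉E′ (subst (_∈ₛ E' S) (edge-injective (trans e′≡p′ (trans (cong (edgeSet k) p′≡p) (sym e≡p))))
                    e′∈E′))

lemma4p6 : ∀ (k : ℕ) → 1 ≤ k → MinimalUncolorable (Hlemma k)
lemma4p6 (suc k′) _ = uncolourable k′ , minimal k′
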